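{- Let $S=\{a,x,y,z\}$ be a reduced skip set of four positive integers with $\nu_2(a)>\nu_2(x)=\nu_2(y)=\nu_2(z)$, and suppose $G(S)$ contains no cycle of length $3$. Then $G(S)$ contains a cycle of length $5$ if and only if the three elements other than $a$ can be labeled $x,y,z$ (in some order) so that all of the following hold: $a=\pm(2x-y-z)$ (for one of the two signs); $x\mid y$; $\gcd(y,z)\mid x$; and $\gcd(a,y)\mid x$.
   Context: $\nu_2(n)$ denotes the exponent of $2$ in the positive integer $n$. A skip set is a finite set of positive integers; it is reduced if the greatest common divisor of its elements is $1$. The skip graph $G(S)$ is the simple graph with vertex set $\mathbb{N}=\{0,1,2,\dots\}$ in which, for each $s\in S$ and each integer $j\ge0$, the vertices $2js$ and $(2j+1)s$ are joined by an edge (an $s$-arc). A cycle is a graph cycle (distinct vertices). -}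

module Defs where

open import Data.Nat using (ℕ; zero; suc; _+_; _*_; _^_; _<_)
open import Data.Nat.Divisibility using (_∣_)
open import Data.Fin using (Fin; inject₁; fromℕ) renaming (zero to fzero; suc to fsuc)
open import Data.List using (List)
open import Data.List.Membership.Propositional using (_∈_)
open import Data.Product using (Σ; ∃; _×_)
open import Data.Sum using (_⊎_)
open import Relation.Nullary using (¬_)
open import Relation.Binary.PropositionalEquality using (_≡_)
open import Function.Definitions using (Injective)

Nu2 : ℕ → ℕ → Set
Nu2 n k = (2 ^ k ∣ n) × ¬ (2 ^ suc k ∣ n)

Adj : List ℕ → ℕ → ℕ → Set
Adj S u v = Σ ℕ λ s → s ∈ S × Σ ℕ λ j →
  ((u ≡ (2 * j) * s × v ≡ (2 * j + 1) * s) ⊎ (v ≡ (2 * j) * s × u ≡ (2 * j + 1) * s))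

HasCycle : List ℕ → ℕ → Set
HasCycle S zero = Data.Empty.⊥
  where import Data.Empty
HasCycle S (suc n) = Σ (Fin (suc n) → ℕ) λ f →
  Injective _≡_ _≡_ f ×
  ((i : Fin n) → Adj S (f (inject₁ i)) (f (fsuc i))) ×
  Adj S (f (fromℕ n)) (f fzero)

module Submission where

-- Let k = ν₂(x) = ν₂(y) = ν₂(z) and call a vertex deep when 2^(k+1) divides it. An a-arc
-- joins two deep vertices, whereas a t-arc {u, u + t} with t ∈ {x, y, z} and 2t ∣ u joins
-- the deep vertex u to the shallow vertex u + t. A 5-cycle therefore has an odd number of
-- a-arcs, and since the a-arcs form a matching it has exactly one; up to rotation and
-- reflection it is a zigzag v₀ →a v₁ →p v₂ ←q v₃ →r v₄ ←s v₀. Its vertices give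
-- a + p + r = q + s, gcd(q, s) ∣ r, gcd(p, r) ∣ q and gcd(a, q) ∣ p. If r = p this is the
-- stated labelling (p, q, s) with a = q + s - 2p; if r ≠ p and s = q then q ∣ r contradicts
-- the sum; otherwise s = p and q = a + r, which produces a triangle. Conversely, a labelling
-- yields the zigzag with p = r = x, q = y, s = z around a base point solving congruences
-- modulo 2a, 2y, 2z; the gcd hypotheses and the equal 2-adic valuations make them
-- compatible, so the Chinese remainder theorem for non-coprime moduli applies.

module Arithmetic where

  open import Data.Nat
  open import Data.Nat.Properties
  open import Data.Nat.Divisibility
  open import Data.Nat.GCD
  open import Data.Nat.LCM
  open import Data.Nat.Primality using (euclidsLemma; prime[2])
  open import Data.Nat.Tactic.RingSolver using (solve-∀)
  open import Data.Product using (∃-syntax; _,_; proj₁; proj₂)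
  open import Data.Sum using (inj₁; inj₂; fromInj₁)
  open import Data.Empty using (⊥-elim)
  open import Function using (_∘_)
  open import Relation.Nullary using (¬_; contradiction)
  open import Relation.Binary.PropositionalEquality
  open import Defs using (Nu2)

  ^-monoʳ-∣ : ∀ m {i j} → i ≤ j → m ^ i ∣ m ^ j
  ^-monoʳ-∣ m {j = j} z≤n       = 1∣ (m ^ j)
  ^-monoʳ-∣ m        (s≤s i≤j) = *-monoʳ-∣ m (^-monoʳ-∣ m i≤j)

  m∣n∧m≢n⇒m+m≤n : ∀ {m n} → m ∣ n → m ≢ n → n ≢ 0 → m + m ≤ n
  m∣n∧m≢n⇒m+m≤n     (divides zero          refl) _   n≢0 = contradiction refl n≢0
  m∣n∧m≢n⇒m+m≤n {m} (divides (suc zero)    refl) m≢n _   = contradiction (sym (+-identityʳ m)) m≢n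
  m∣n∧m≢n⇒m+m≤n {m} (divides (suc (suc c)) refl) _   _   = +-monoʳ-≤ m (m≤m+n m (c * m))

  m≢m+n : ∀ m {n} → n ≢ 0 → m ≢ m + n
  m≢m+n m {n} n≢0 m≡m+n = n≢0 (+-cancelˡ-≡ m n 0 (trans (sym m≡m+n) (sym (+-identityʳ m))))

  m+n≤n⇒m≡0 : ∀ {m n} → m + n ≤ n → m ≡ 0
  m+n≤n⇒m≡0 {m} {n} m+n≤n = n≤0⇒n≡0 (+-cancelʳ-≤ n m 0 m+n≤n)

  ¬2∣⇒odd : ∀ {q} → ¬ 2 ∣ q → ∃[ h ] q ≡ 2 * h + 1
  ¬2∣⇒odd {zero}        ¬2∣q = contradiction (2 ∣0) ¬2∣q
  ¬2∣⇒odd {suc zero}    _    = 0 , refl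
  ¬2∣⇒odd {suc (suc q)} ¬2∣q with ¬2∣⇒odd (¬2∣q ∘ ∣m∣n⇒∣m+n ∣-refl)
  ... | h , refl = suc h , step h
    where
    step : ∀ h → 2 + (2 * h + 1) ≡ 2 * suc h + 1
    step = solve-∀

  module TwoAdic (k : ℕ) where

    Nu2⇒≢0 : ∀ {n} → Nu2 n k → n ≢ 0
    Nu2⇒≢0 (_ , ¬2^[1+k]∣n) refl = ¬2^[1+k]∣n (_ ∣0)

    Nu2⇒odd*2^k : ∀ {n} → Nu2 n k → ∃[ h ] n ≡ (2 * h + 1) * 2 ^ k
    Nu2⇒odd*2^k {n} (divides q n≡q*2^k , ¬2^[1+k]∣n) = h , trans n≡q*2^k (cong (_* 2 ^ k) q≡2h+1)
      where
      ¬2∣q : ¬ 2 ∣ q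
      ¬2∣q (divides j refl) = ¬2^[1+k]∣n (divides j (trans n≡q*2^k (*-assoc j 2 (2 ^ k))))
      h = proj₁ (¬2∣⇒odd ¬2∣q)
      q≡2h+1 = proj₂ (¬2∣⇒odd ¬2∣q)

    Nu2⇒2^[1+k]∣m+n : ∀ {m n} → Nu2 m k → Nu2 n k → 2 ^ suc k ∣ m + n
    Nu2⇒2^[1+k]∣m+n νm νn with Nu2⇒odd*2^k νm | Nu2⇒odd*2^k νn
    ... | h , refl | h′ , refl = divides (h + h′ + 1) (sum-of-odds h h′ (2 ^ k))
      where
      sum-of-odds : ∀ h h′ p → (2 * h + 1) * p + (2 * h′ + 1) * p ≡ (h + h′ + 1) * (2 * p)
      sum-of-odds = solve-∀

    Nu2⇒2m∣n : ∀ {m n} → Nu2 m k → m ∣ n → 2 ^ suc k ∣ n → 2 * m ∣ n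
    Nu2⇒2m∣n {m} νm (divides w refl) 2^[1+k]∣wm with Nu2⇒odd*2^k νm
    ... | h , refl = *-monoˡ-∣ m 2∣w
      where
      2∣w*odd : 2 ∣ w * (2 * h + 1)
      2∣w*odd = *-cancelʳ-∣ (2 ^ k) {{m^n≢0 2 k}}
        (subst (2 ^ suc k ∣_) (sym (*-assoc w (2 * h + 1) (2 ^ k))) 2^[1+k]∣wm)
      2∤odd : ¬ 2 ∣ 2 * h + 1
      2∤odd 2∣odd with ∣1⇒≡1 (∣m+n∣m⇒∣n 2∣odd (m∣m*n h))
      ... | ()
      2∣w : 2 ∣ w
      2∣w = fromInj₁ (⊥-elim ∘ 2∤odd) (euclidsLemma w (2 * h + 1) prime[2] 2∣w*odd)

    Nu2-gcd : ∀ {m n} → Nu2 m k → 2 ^ k ∣ n → Nu2 (gcd m n) k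
    Nu2-gcd {m} {n} (2^k∣m , ¬2^[1+k]∣m) 2^k∣n =
      gcd-greatest 2^k∣m 2^k∣n , ¬2^[1+k]∣m ∘ (λ h → ∣-trans h (gcd[m,n]∣m m n))

  n≡m⇒m∣gcd[m,n] : ∀ {m n} → n ≡ m → m ∣ gcd m n
  n≡m⇒m∣gcd[m,n] n≡m = gcd-greatest ∣-refl (∣-reflexive (sym n≡m))

  gcd*gcd-greatest : ∀ {d m n p q} → d ∣ m * n → d ∣ m * q → d ∣ p * n → d ∣ p * q →
                     d ∣ gcd m p * gcd n q
  gcd*gcd-greatest {d} {m} {n} {p} {q} d∣mn d∣mq d∣pn d∣pq =
    subst (d ∣_) (sym expand) (gcd-greatest (gcd-greatest d∣mn d∣mq) (gcd-greatest d∣pn d∣pq))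
    where
    gcd-*ʳ : ∀ i j c → gcd i j * c ≡ gcd (i * c) (j * c)
    gcd-*ʳ i j c = trans (*-comm (gcd i j) c)
      (trans (c*gcd[m,n]≡gcd[cm,cn] c i j) (cong₂ gcd (*-comm c i) (*-comm c j)))
    expand : gcd m p * gcd n q ≡ gcd (gcd (m * n) (m * q)) (gcd (p * n) (p * q))
    expand = trans (gcd-*ʳ m p (gcd n q))
      (cong₂ gcd (c*gcd[m,n]≡gcd[cm,cn] m n q) (c*gcd[m,n]≡gcd[cm,cn] p n q))

  -- With e = gcd (gcd m p) (gcd n p), the four products of a generator of gcd m p with one of
  -- gcd n p are divisible by G * e; hence G * e ∣ gcd m p * gcd n p = e * lcm (gcd m p) (gcd n p).
  gcd[lcm[m,n],p]∣lcm[gcd[m,p],gcd[n,p]] : ∀ m n p → gcd (lcm m n) p ∣ lcm (gcd m p) (gcd n p)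
  gcd[lcm[m,n],p]∣lcm[gcd[m,p],gcd[n,p]] m n zero
    rewrite gcd-identityʳ (lcm m n) | gcd-identityʳ m | gcd-identityʳ n = ∣-refl
  gcd[lcm[m,n],p]∣lcm[gcd[m,p],gcd[n,p]] m n p@(suc _) =
    *-cancelˡ-∣ e {{≢-nonZero e≢0}}
      (subst₂ _∣_ (*-comm G e) (sym (gcd*lcm g₁ g₂))
        (gcd*gcd-greatest {m = m} {n} {p} {p} Ge∣mn Ge∣mp Ge∣pn Ge∣pp))
    where
    G  = gcd (lcm m n) p
    g₁ = gcd m p
    g₂ = gcd n p
    e  = gcd g₁ g₂
    e≢0 : e ≢ 0
    e≢0 = gcd[m,n]≢0 g₁ g₂ (inj₁ (gcd[m,n]≢0 m p (inj₂ (λ ()))))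
    G∣p : G ∣ p
    G∣p = gcd[m,n]∣n (lcm m n) p
    e∣m : e ∣ m
    e∣m = ∣-trans (gcd[m,n]∣m g₁ g₂) (gcd[m,n]∣m m p)
    e∣n : e ∣ n
    e∣n = ∣-trans (gcd[m,n]∣n g₁ g₂) (gcd[m,n]∣m n p)
    e∣p : e ∣ p
    e∣p = ∣-trans (gcd[m,n]∣m g₁ g₂) (gcd[m,n]∣n m p)
    Ge∣mn : G * e ∣ m * n
    Ge∣mn = subst (G * e ∣_) (trans (*-comm (lcm m n) (gcd m n)) (gcd*lcm m n))
      (*-pres-∣ (gcd[m,n]∣m (lcm m n) p) (gcd-greatest e∣m e∣n))
    Ge∣mp : G * e ∣ m * p
    Ge∣mp = subst (G * e ∣_) (*-comm p m) (*-pres-∣ G∣p e∣m)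
    Ge∣pn : G * e ∣ p * n
    Ge∣pn = *-pres-∣ G∣p e∣n
    Ge∣pp : G * e ∣ p * p
    Ge∣pp = *-pres-∣ G∣p e∣p

module ChineseRemainder where

  open import Data.Nat as ℕ using (ℕ)
  import Data.Nat.Properties as ℕₚ
  import Data.Nat.Divisibility as ℕᵈ
  open import Data.Nat.GCD using (gcd; gcd-GCD; gcd-comm; c*gcd[m,n]≡gcd[cm,cn]; module Bézout)
  open import Data.Nat.LCM using (lcm; m∣lcm[m,n]; n∣lcm[m,n]; lcm-least)
  open import Data.Integer
  open import Data.Integer.Properties
  open import Data.Integer.Divisibility.Signed
  open import Data.Integer.DivMod using (_%ℕ_; _/ℕ_; a≡a%ℕn+[a/ℕn]*n)
  open import Data.Integer.Tactic.RingSolver using (solve-∀; solve)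
  open import Data.List using (_∷_; [])
  open import Data.Product using (∃-syntax; ∃₂; _×_; _,_)
  open import Relation.Binary.PropositionalEquality
  open import Defs using (Nu2)
  open Arithmetic using (gcd[lcm[m,n],p]∣lcm[gcd[m,p],gcd[n,p]])
  open ≡-Reasoning

  ℕ∣⇒ℤ∣ : ∀ {m n} → m ℕᵈ.∣ n → + m ∣ + n
  ℕ∣⇒ℤ∣ = ∣ᵤ⇒∣

  bézout : ∀ m n → ∃₂ λ α β → + gcd m n ≡ α * + m + β * + n
  bézout m n with Bézout.identity (gcd-GCD m n)
  ... | Bézout.+- x y eq = + x , - + y , rearrange (+ gcd m n) (+ x) (+ y) (+ m) (+ n) (lift eq)
    where
    lift : gcd m n ℕ.+ y ℕ.* n ≡ x ℕ.* m → + gcd m n + + y * + n ≡ + x * + m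
    lift eq = trans (cong (λ t → + gcd m n + t) (sym (pos-* y n))) (trans (cong +_ eq) (pos-* x m))
    rearrange : ∀ g x y m n → g + y * n ≡ x * m → g ≡ x * m + - y * n
    rearrange g x y m n eq = begin
      g                 ≡⟨ solve (g ∷ y ∷ n ∷ []) ⟩
      g + y * n - y * n ≡⟨ cong (_- y * n) eq ⟩
      x * m - y * n     ≡⟨ solve (x ∷ m ∷ y ∷ n ∷ []) ⟩
      x * m + - y * n   ∎
  ... | Bézout.-+ x y eq = - + x , + y , rearrange (+ gcd m n) (+ x) (+ y) (+ m) (+ n) (lift eq)
    where
    lift : gcd m n ℕ.+ x ℕ.* m ≡ y ℕ.* n → + gcd m n + + x * + m ≡ + y * + n
    lift eq = trans (cong (λ t → + gcd m n + t) (sym (pos-* x m))) (trans (cong +_ eq) (pos-* y n))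
    rearrange : ∀ g x y m n → g + x * m ≡ y * n → g ≡ - x * m + y * n
    rearrange g x y m n eq = begin
      g                 ≡⟨ solve (g ∷ x ∷ m ∷ []) ⟩
      g + x * m - x * m ≡⟨ cong (_- x * m) eq ⟩
      y * n - x * m     ≡⟨ solve (x ∷ m ∷ y ∷ n ∷ []) ⟩
      - x * m + y * n   ∎

  crt₂ : ∀ m n {s} → + gcd m n ∣ s → ∃[ N ] (+ m ∣ N) × (+ n ∣ N + s)
  crt₂ m n {s} (divides c s≡c*g) with bézout m n
  ... | α , β , g≡αm+βn =
    - (c * α * + m) , ∣m⇒∣-m (∣n⇒∣m*n (c * α) ∣-refl) , divides (c * β) N+s≡cβn
    where
    cancel : ∀ c α β m n → - (c * α * m) + c * (α * m + β * n) ≡ c * β * n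
    cancel = solve-∀
    N+s≡cβn : - (c * α * + m) + s ≡ c * β * + n
    N+s≡cβn = begin
      - (c * α * + m) + s                         ≡⟨ cong (λ t → - (c * α * + m) + t) s≡c*g ⟩
      - (c * α * + m) + c * + gcd m n             ≡⟨ cong (λ t → - (c * α * + m) + c * t) g≡αm+βn ⟩
      - (c * α * + m) + c * (α * + m + β * + n)   ≡⟨ cancel c α β (+ m) (+ n) ⟩
      c * β * + n                                 ∎

  crt₃ : ∀ m₁ m₂ n {s} → + gcd n m₁ ∣ s → + gcd n m₂ ∣ s →
         ∃[ N ] (+ m₁ ∣ N) × (+ m₂ ∣ N) × (+ n ∣ N + s)
  crt₃ m₁ m₂ n {s} gcd₁∣s gcd₂∣s =
    let N , lcm∣N , n∣N+s = crt₂ (lcm m₁ m₂) n {s} (∣ᵤ⇒∣ gcd∣s)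
    in N , ∣-trans (ℕ∣⇒ℤ∣ (m∣lcm[m,n] m₁ m₂)) lcm∣N
         , ∣-trans (ℕ∣⇒ℤ∣ (n∣lcm[m,n] m₁ m₂)) lcm∣N
         , n∣N+s
    where
    g₁∣s : gcd m₁ n ℕᵈ.∣ ∣ s ∣
    g₁∣s = subst (ℕᵈ._∣ ∣ s ∣) (gcd-comm n m₁) (∣⇒∣ᵤ gcd₁∣s)
    g₂∣s : gcd m₂ n ℕᵈ.∣ ∣ s ∣
    g₂∣s = subst (ℕᵈ._∣ ∣ s ∣) (gcd-comm n m₂) (∣⇒∣ᵤ gcd₂∣s)
    gcd∣s : gcd (lcm m₁ m₂) n ℕᵈ.∣ ∣ s ∣
    gcd∣s = ℕᵈ.∣-trans {gcd (lcm m₁ m₂) n} {lcm (gcd m₁ n) (gcd m₂ n)}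
      (gcd[lcm[m,n],p]∣lcm[gcd[m,p],gcd[n,p]] m₁ m₂ n) (lcm-least {gcd m₁ n} {gcd m₂ n} g₁∣s g₂∣s)

  representative : ∀ M .{{_ : ℕ.NonZero M}} N₀ b → ∃[ N ] + M ∣ + (b ℕ.+ N) - N₀
  representative M N₀ b = r , divides (- q) (begin
    + b + + r - N₀        ≡⟨ regroup (+ b) (+ r) N₀ ⟩
    + r - (N₀ - + b)      ≡⟨ cong (λ t → + r - t) (a≡a%ℕn+[a/ℕn]*n (N₀ - + b) M) ⟩
    + r - (+ r + q * + M) ≡⟨ cancel (+ r) q (+ M) ⟩
    - q * + M             ∎)
    where
    regroup : ∀ b r N → b + r - N ≡ r - (N - b)
    regroup = solve-∀
    cancel : ∀ r q M → r - (r + q * M) ≡ - q * M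
    cancel = solve-∀
    r = (N₀ - + b) %ℕ M
    q = (N₀ - + b) /ℕ M

  ∣-shift : ∀ {d} i j {s} → d ∣ i - j → d ∣ j + s → d ∣ i + s
  ∣-shift {d} i j {s} d∣i-j d∣j+s = subst (d ∣_) (telescope i j s) (∣m∣n⇒∣m+n d∣i-j d∣j+s)
    where
    telescope : ∀ i j s → i - j + (j + s) ≡ i + s
    telescope = solve-∀

  ∣-shift₀ : ∀ {d} i j → d ∣ i - j → d ∣ j → d ∣ i
  ∣-shift₀ {d} i j d∣i-j d∣j = subst (d ∣_) (telescope i j) (∣m∣n⇒∣m+n d∣i-j d∣j)
    where
    telescope : ∀ i j → i - j + j ≡ i
    telescope = solve-∀

  natural-solution : ∀ {m₁ m₂ n} .{{_ : ℕ.NonZero m₁}} .{{_ : ℕ.NonZero m₂}} .{{_ : ℕ.NonZero n}} {s} →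
    ∃[ N ] (+ m₁ ∣ N) × (+ m₂ ∣ N) × (+ n ∣ N + s) → ∀ b →
    ∃[ N ] (m₁ ℕᵈ.∣ b ℕ.+ N) × (m₂ ℕᵈ.∣ b ℕ.+ N) × (+ n ∣ + (b ℕ.+ N) + s)
  natural-solution {m₁} {m₂} {n} (N₀ , m₁∣N₀ , m₂∣N₀ , n∣N₀+s) b =
    let N , M∣N-N₀ = representative M {{M≢0}} N₀ b
    in N , ∣⇒∣ᵤ (∣-shift₀ (+ (b ℕ.+ N)) N₀ (∣-trans (ℕ∣⇒ℤ∣ m₁∣M) M∣N-N₀) m₁∣N₀)
         , ∣⇒∣ᵤ (∣-shift₀ (+ (b ℕ.+ N)) N₀ (∣-trans (ℕ∣⇒ℤ∣ m₂∣M) M∣N-N₀) m₂∣N₀)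
         , ∣-shift (+ (b ℕ.+ N)) N₀ (∣-trans (ℕ∣⇒ℤ∣ n∣M) M∣N-N₀) n∣N₀+s
    where
    M = m₁ ℕ.* m₂ ℕ.* n
    M≢0 = ℕₚ.m*n≢0 (m₁ ℕ.* m₂) n {{ℕₚ.m*n≢0 m₁ m₂}}
    m₁∣M : m₁ ℕᵈ.∣ M
    m₁∣M = ℕᵈ.∣-trans (ℕᵈ.m∣m*n m₂) (ℕᵈ.m∣m*n n)
    m₂∣M : m₂ ℕᵈ.∣ M
    m₂∣M = ℕᵈ.∣-trans (ℕᵈ.n∣m*n m₁) (ℕᵈ.m∣m*n n)
    n∣M : n ℕᵈ.∣ M
    n∣M = ℕᵈ.n∣m*n (m₁ ℕ.* m₂)

  chinese-remainder : ∀ m₁ m₂ n .{{_ : ℕ.NonZero m₁}} .{{_ : ℕ.NonZero m₂}} .{{_ : ℕ.NonZero n}} {s} →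
    + gcd n m₁ ∣ s → + gcd n m₂ ∣ s → ∀ b →
    ∃[ N ] (m₁ ℕᵈ.∣ b ℕ.+ N) × (m₂ ℕᵈ.∣ b ℕ.+ N) × (+ n ∣ + (b ℕ.+ N) + s)
  chinese-remainder m₁ m₂ n g₁∣s g₂∣s = natural-solution (crt₃ m₁ m₂ n g₁∣s g₂∣s)

  module TwoAdic (k : ℕ) where

    open Arithmetic.TwoAdic k using (Nu2⇒2m∣n; Nu2⇒2^[1+k]∣m+n)

    Nu2⇒2^[1+k]∣m-n : ∀ {m n} → Nu2 m k → Nu2 n k → + (2 ℕ.^ ℕ.suc k) ∣ + m - + n
    Nu2⇒2^[1+k]∣m-n {m} {n} νm νn = subst (+ (2 ℕ.^ ℕ.suc k) ∣_) (cancel (+ m) (+ n))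
      (∣m∣n⇒∣m-n (ℕ∣⇒ℤ∣ (Nu2⇒2^[1+k]∣m+n νm νn)) (ℕ∣⇒ℤ∣ (Nu2⇒2^[1+k]∣m+n νn νn)))
      where
      cancel : ∀ i j → i + j - (j + j) ≡ i - j
      cancel = solve-∀

    gcd[2m,2n]∣ : ∀ m n {c} → Nu2 (gcd m n) k → + gcd m n ∣ c → + (2 ℕ.^ ℕ.suc k) ∣ c →
                  + gcd (2 ℕ.* m) (2 ℕ.* n) ∣ c
    gcd[2m,2n]∣ m n {c} ν g∣c 2^[1+k]∣c = subst (λ d → + d ∣ c) (c*gcd[m,n]≡gcd[cm,cn] 2 m n)
      (∣ᵤ⇒∣ (Nu2⇒2m∣n ν (∣⇒∣ᵤ g∣c) (∣⇒∣ᵤ 2^[1+k]∣c)))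

  +[m+n]+[o-m]≡+[n+o] : ∀ m n o → + (m ℕ.+ n) + (+ o - + m) ≡ + (n ℕ.+ o)
  +[m+n]+[o-m]≡+[n+o] m n o = cancel (+ m) (+ n) (+ o)
    where
    cancel : ∀ m n o → m + n + (o - m) ≡ n + o
    cancel = solve-∀

module DistinctMembers where

  open import Data.Nat using (_≤_; s≤s⁻¹)
  open import Data.List using (List; []; _∷_; _++_; [_]; length)
  open import Data.List.Membership.Propositional using (_∈_)
  open import Data.List.Membership.Propositional.Properties using (∈-∃++)
  open import Data.List.Relation.Unary.All as All using (All; []; _∷_)
  open import Data.List.Relation.Unary.Any using (here; there)
  open import Data.List.Relation.Unary.Unique.Propositional using (Unique; []; _∷_)
  open import Data.List.Relation.Binary.Permutation.Propositional using (_↭_; ↭-refl; ↭-sym; ↭-trans; prep)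
  open import Data.List.Relation.Binary.Permutation.Propositional.Properties using (shift; ∈-resp-↭; ↭-length)
  open import Data.Product using (_×_; _,_)
  open import Relation.Nullary using (contradiction)
  open import Relation.Binary.PropositionalEquality using (_≢_; refl; subst; sym)

  ↭-of-distinct-members : ∀ {A : Set} {ps xs : List A} →
    Unique ps → All (_∈ xs) ps → length xs ≤ length ps → ps ↭ xs
  ↭-of-distinct-members {ps = []} {[]}    _ _ _  = ↭-refl
  ↭-of-distinct-members {ps = []} {_ ∷ _} _ _ ()
  ↭-of-distinct-members {ps = p ∷ ps} (p∉ps ∷ ps-unique) (p∈xs ∷ ps⊆xs) |xs|≤ with ∈-∃++ p∈xs
  ... | ys , zs , refl =
    ↭-trans (prep p (↭-of-distinct-members ps-unique (All.zipWith drop-p (p∉ps , ps⊆xs)) |ys++zs|≤))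
            (↭-sym moved)
    where
    moved = shift p ys zs
    drop-p : ∀ {q} → p ≢ q × q ∈ ys ++ [ p ] ++ zs → q ∈ ys ++ zs
    drop-p (p≢q , q∈xs) with ∈-resp-↭ moved q∈xs
    ... | here q≡p  = contradiction (sym q≡p) p≢q
    ... | there q∈ = q∈
    |ys++zs|≤ = s≤s⁻¹ (subst (_≤ _) (↭-length moved) |xs|≤)

module Arcs where

  open import Data.Nat
  open import Data.Nat.Divisibility
  open import Data.Nat.Tactic.RingSolver using (solve-∀)
  open import Data.List using (List)
  open import Data.List.Membership.Propositional using (_∈_)
  open import Data.Product using (∃-syntax; _×_; _,_; proj₁; proj₂)
  open import Data.Sum using (_⊎_; inj₁; inj₂)
  import Data.Sum as Sum
  open import Relation.Binary.PropositionalEquality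
  open import Defs using (Adj)

  Arc : ℕ → ℕ → ℕ → Set
  Arc s u v = 2 * s ∣ u × v ≡ u + s

  module _ {s u v : ℕ} (arc : Arc s u v) where

    arc-∣-lower : s ∣ u
    arc-∣-lower = ∣-trans (n∣m*n 2) (proj₁ arc)

    arc-∣-upper : ∀ {d} → d ∣ u → d ∣ s → d ∣ v
    arc-∣-upper d∣u d∣s = subst (_ ∣_) (sym (proj₂ arc)) (∣m∣n⇒∣m+n d∣u d∣s)

    arc-∣-label : ∀ {d} → d ∣ u → d ∣ v → d ∣ s
    arc-∣-label d∣u d∣v = ∣m+n∣m⇒∣n (subst (_ ∣_) (proj₂ arc) d∣v) d∣u

  module _ {S : List ℕ} where

    private
      lower : ∀ j s → j * (2 * s) ≡ 2 * j * s
      lower = solve-∀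
      upper : ∀ j s → 2 * j * s + s ≡ (2 * j + 1) * s
      upper = solve-∀

    arc⇒adj : ∀ {s u v} → s ∈ S → Arc s u v → Adj S u v
    arc⇒adj {s} s∈S (divides j refl , refl) =
      s , s∈S , j , inj₁ (lower j s , trans (cong (_+ s) (lower j s)) (upper j s))

    adj⇒arc : ∀ {u v} → Adj S u v → ∃[ s ] s ∈ S × (Arc s u v ⊎ Arc s v u)
    adj⇒arc (s , s∈S , j , inj₁ (refl , refl)) =
      s , s∈S , inj₁ (divides j (sym (lower j s)) , sym (upper j s))
    adj⇒arc (s , s∈S , j , inj₂ (refl , refl)) =
      s , s∈S , inj₂ (divides j (sym (lower j s)) , sym (upper j s))

    adj-sym : ∀ {u v} → Adj S u v → Adj S v u
    adj-sym (s , s∈S , j , edge) = s , s∈S , j , Sum.swap edge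

module Cycles where

  open import Data.Nat using (ℕ; suc)
  open import Data.Fin using (zero; suc; inject₁; fromℕ)
  open import Data.Fin.Patterns using (0F; 1F; 2F; 3F; 4F)
  open import Data.Vec using (Vec; lookup)
  open import Data.Vec.Relation.Unary.Unique.Propositional using (Unique)
  open import Data.Vec.Relation.Unary.Unique.Propositional.Properties using (lookup-injective)
  open import Data.List using (List)
  open import Data.Product using (_,_)
  open import Function using (case_of_)
  open import Relation.Binary.Definitions using (Symmetric)
  open import Relation.Binary.PropositionalEquality using (_≢_; ≢-sym)
  open import Defs using (Adj; HasCycle)

  record Pentagon {A : Set} (_~_ : A → A → Set) : Set where
    field
      v₀ v₁ v₂ v₃ v₄ : A
      e₀₁ : v₀ ~ v₁
      e₁₂ : v₁ ~ v₂
      e₂₃ : v₂ ~ v₃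
      e₃₄ : v₃ ~ v₄
      e₄₀ : v₄ ~ v₀
      v₀≢v₂ : v₀ ≢ v₂
      v₁≢v₃ : v₁ ≢ v₃
      v₂≢v₄ : v₂ ≢ v₄
      v₃≢v₀ : v₃ ≢ v₀
      v₄≢v₁ : v₄ ≢ v₁

  module _ {A : Set} {_~_ : A → A → Set} where

    rotate : Pentagon _~_ → Pentagon _~_
    rotate P = record
      { v₀ = v₁ ; v₁ = v₂ ; v₂ = v₃ ; v₃ = v₄ ; v₄ = v₀
      ; e₀₁ = e₁₂ ; e₁₂ = e₂₃ ; e₂₃ = e₃₄ ; e₃₄ = e₄₀ ; e₄₀ = e₀₁
      ; v₀≢v₂ = v₁≢v₃ ; v₁≢v₃ = v₂≢v₄ ; v₂≢v₄ = v₃≢v₀ ; v₃≢v₀ = v₄≢v₁ ; v₄≢v₁ = v₀≢v₂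
      }
      where open Pentagon P

    reflect : Symmetric _~_ → Pentagon _~_ → Pentagon _~_
    reflect sym P = record
      { v₀ = v₁ ; v₁ = v₀ ; v₂ = v₄ ; v₃ = v₃ ; v₄ = v₂
      ; e₀₁ = sym e₀₁ ; e₁₂ = sym e₄₀ ; e₂₃ = sym e₃₄ ; e₃₄ = sym e₂₃ ; e₄₀ = sym e₁₂
      ; v₀≢v₂ = ≢-sym v₄≢v₁ ; v₁≢v₃ = ≢-sym v₃≢v₀ ; v₂≢v₄ = ≢-sym v₂≢v₄
      ; v₃≢v₀ = ≢-sym v₁≢v₃ ; v₄≢v₁ = ≢-sym v₀≢v₂
      }
      where open Pentagon P

  module _ {S : List ℕ} where

    cycle-of-unique : ∀ {n} (vs : Vec ℕ (suc n)) → Unique vs →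
      (∀ i → Adj S (lookup vs (inject₁ i)) (lookup vs (suc i))) →
      Adj S (lookup vs (fromℕ n)) (lookup vs zero) → HasCycle S (suc n)
    cycle-of-unique vs distinct steps closing =
      lookup vs , (λ {i} {j} → lookup-injective distinct i j) , steps , closing

    cycle⇒pentagon : HasCycle S 5 → Pentagon (Adj S)
    cycle⇒pentagon (f , injective , step , closing) = record
      { v₀ = f 0F ; v₁ = f 1F ; v₂ = f 2F ; v₃ = f 3F ; v₄ = f 4F
      ; e₀₁ = step 0F ; e₁₂ = step 1F ; e₂₃ = step 2F ; e₃₄ = step 3F ; e₄₀ = closing
      ; v₀≢v₂ = λ e → case injective {0F} {2F} e of λ ()
      ; v₁≢v₃ = λ e → case injective {1F} {3F} e of λ ()
      ; v₂≢v₄ = λ e → case injective {2F} {4F} e of λ ()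
      ; v₃≢v₀ = λ e → case injective {3F} {0F} e of λ ()
      ; v₄≢v₁ = λ e → case injective {4F} {1F} e of λ ()
      }

module Characterisation where

  open import Data.Nat as ℕ using (ℕ)
  import Data.Nat.Properties as ℕ
  open import Data.Nat.Divisibility using (_∣_)
  open import Data.Nat.GCD using (gcd)
  open import Data.Integer using (+_; -_; _+_; _-_; _*_)
  open import Data.Integer.Properties using (+-injective)
  open import Data.Integer.Tactic.RingSolver using (solve)
  open import Data.List using (List; _∷_; [])
  open import Data.List.Relation.Binary.Permutation.Propositional using (_↭_)
  open import Data.Product using (Σ; _×_)
  open import Data.Sum using (_⊎_; inj₁; inj₂)
  open import Relation.Nullary using (contradiction)
  open import Relation.Binary.PropositionalEquality
  open Arithmetic using (m∣n∧m≢n⇒m+m≤n; m+n≤n⇒m≡0)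
  open ≡-Reasoning

  Balanced : ℕ → ℕ → ℕ → ℕ → Set
  Balanced a x y z = (+ a ≡ (+ 2) * (+ x) - (+ y) - (+ z)) ⊎ (+ a ≡ - ((+ 2) * (+ x) - (+ y) - (+ z)))

  FiveCycleLabelling : ℕ → List ℕ → Set
  FiveCycleLabelling a T = Σ ℕ λ x′ → Σ ℕ λ y′ → Σ ℕ λ z′ →
    ((x′ ∷ y′ ∷ z′ ∷ []) ↭ T) × Balanced a x′ y′ z′ ×
    (x′ ∣ y′) × (gcd y′ z′ ∣ x′) × (gcd a y′ ∣ x′)

  sum⇒balanced : ∀ {a x y z} → a ℕ.+ x ℕ.+ x ≡ y ℕ.+ z → Balanced a x y z
  sum⇒balanced {a} {x} {y} {z} eq = inj₂ (solved (+ a) (+ x) (+ y) (+ z) (cong +_ eq))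
    where
    solved : ∀ A X Y Z → A + X + X ≡ Y + Z → A ≡ - (+ 2 * X - Y - Z)
    solved A X Y Z eq = begin
      A                     ≡⟨ solve (A ∷ X ∷ []) ⟩
      A + X + X - X - X     ≡⟨ cong (λ t → t - X - X) eq ⟩
      Y + Z - X - X         ≡⟨ solve (X ∷ Y ∷ Z ∷ []) ⟩
      - (+ 2 * X - Y - Z)   ∎

  balanced⇒sum : ∀ {a x y z} → a ≢ 0 → x ∣ y → x ≢ y → y ≢ 0 →
                 Balanced a x y z → a ℕ.+ x ℕ.+ x ≡ y ℕ.+ z
  balanced⇒sum {a} {x} {y} {z} a≢0 x∣y x≢y y≢0 (inj₁ eq) = contradiction (ℕ.m+n≡0⇒m≡0 a a+z≡0) a≢0
    where
    solved : ∀ A X Y Z → A ≡ + 2 * X - Y - Z → A + Z + Y ≡ X + X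
    solved _ X Y Z refl = solve (X ∷ Y ∷ Z ∷ [])
    a+z+y≡x+x = +-injective (solved (+ a) (+ x) (+ y) (+ z) eq)
    a+z≡0 = m+n≤n⇒m≡0 (subst (ℕ._≤ y) (sym a+z+y≡x+x) (m∣n∧m≢n⇒m+m≤n x∣y x≢y y≢0))
  balanced⇒sum {a} {x} {y} {z} _ _ _ _ (inj₂ eq) = +-injective (solved (+ a) (+ x) (+ y) (+ z) eq)
    where
    solved : ∀ A X Y Z → A ≡ - (+ 2 * X - Y - Z) → A + X + X ≡ Y + Z
    solved _ X Y Z refl = solve (X ∷ Y ∷ Z ∷ [])

open import Defs
open import Data.Nat using (ℕ; suc; _+_; _^_; _<_; _>_)
open import Data.Nat.Properties using (>⇒≢; ≤-refl)
open import Data.Nat.Divisibility using (_∣_; ∣-trans)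
open import Data.Nat.GCD using (gcd)
open import Data.List using (List; _∷_; [])
open import Data.List.Membership.Propositional using (_∈_)
open import Data.List.Relation.Unary.All using (All; []; _∷_)
open import Data.List.Relation.Unary.AllPairs using ([]; _∷_)
open import Data.List.Relation.Unary.Unique.Propositional using (Unique)
open import Data.List.Relation.Binary.Permutation.Propositional using (_↭_)
open import Data.Product using (Σ; ∃; _×_; _,_; proj₁)
open import Data.Sum using (_⊎_)
open import Relation.Nullary using (¬_)
open import Relation.Binary.PropositionalEquality using (_≡_; _≢_)
open import Function.Bundles using (_⇔_; mk⇔)
open Arithmetic using (^-monoʳ-∣)

module SkipGraph (a k : ℕ) (T : List ℕ) (a≢0 : a ≢ 0) (2^[1+k]∣a : 2 ^ suc k ∣ a)
                 (ν₂[T]≡k : All (λ t → Nu2 t k) T) where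

  open import Data.Nat
  open import Data.Nat.Properties
  open import Data.Nat.Divisibility
  open import Data.Nat.GCD using (gcd; gcd[m,n]∣m; gcd[m,n]∣n; gcd-greatest; gcd-comm)
  open import Data.Nat.Tactic.RingSolver using (solve-∀)
  import Data.Integer as ℤ
  import Data.Integer.Divisibility.Signed as ℤ
  open import Data.Fin using (Fin; inject₁; suc)
  open import Data.Fin.Patterns using (0F; 1F; 2F; 3F)
  open import Data.Vec using (Vec; lookup; []; _∷_)
  open import Data.Vec.Relation.Unary.All using ([]; _∷_)
  open import Data.Vec.Relation.Unary.AllPairs using ([]; _∷_)
  import Data.Vec.Relation.Unary.Unique.Propositional as Vec using (Unique)
  open import Data.List using (_∷_; []; length)
  open import Data.List.Membership.Propositional using (_∈_)
  open import Data.List.Relation.Unary.Any using (here; there)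
  open import Data.List.Relation.Unary.All as All using (_∷_; [])
  open import Data.List.Relation.Unary.AllPairs using (_∷_; [])
  open import Data.List.Relation.Unary.Unique.Propositional using (Unique)
  open import Data.List.Relation.Binary.Permutation.Propositional using (↭-sym; ↭⇒↭ₛ)
  open import Data.List.Relation.Binary.Permutation.Propositional.Properties using (∈-resp-↭)
  open import Data.Product using (∃-syntax; _×_; _,_; proj₁; proj₂; uncurry)
  open import Data.Sum using (_⊎_; inj₁; inj₂)
  open import Data.Empty using (⊥; ⊥-elim)
  open import Function using (_∘_)
  open import Relation.Nullary using (¬_; Dec; yes; no; contradiction)
  open import Relation.Binary.PropositionalEquality
  open import Data.List.Relation.Binary.Permutation.Setoid.Properties (setoid ℕ) using (Unique-resp-↭)
  open import Defs using (Adj; HasCycle)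
  open Arcs
  open Cycles
  open DistinctMembers using (↭-of-distinct-members)
  open Characterisation using (FiveCycleLabelling; sum⇒balanced; balanced⇒sum)
  open Arithmetic
  open Arithmetic.TwoAdic k
  open ChineseRemainder
    using (ℕ∣⇒ℤ∣; chinese-remainder; +[m+n]+[o-m]≡+[n+o])
  open ChineseRemainder.TwoAdic k
  open ≡-Reasoning

  S : List ℕ
  S = a ∷ T

  Deep : ℕ → Set
  Deep v = 2 ^ suc k ∣ v

  AEdge : ℕ → ℕ → Set
  AEdge u v = Arc a u v ⊎ Arc a v u

  TArc : ℕ → ℕ → Set
  TArc u v = ∃[ t ] t ∈ T × Arc t u v

  TEdge : ℕ → ℕ → Set
  TEdge u v = TArc u v ⊎ TArc v u

  a-arc-deep : ∀ {u v} → Arc a u v → Deep u × Deep v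
  a-arc-deep (2a∣u , refl) = deep-u , ∣m∣n⇒∣m+n deep-u 2^[1+k]∣a
    where
    deep-u = ∣-trans 2^[1+k]∣a (∣-trans (n∣m*n 2) 2a∣u)

  t-arc-flips : ∀ {t u v} → t ∈ T → Arc t u v → Deep u × ¬ Deep v
  t-arc-flips t∈T (2t∣u , refl) with All.lookup ν₂[T]≡k t∈T
  ... | 2^k∣t , ¬2^[1+k]∣t = deep-u , λ deep-v → ¬2^[1+k]∣t (∣m+n∣m⇒∣n deep-v deep-u)
    where
    deep-u = ∣-trans (*-monoʳ-∣ 2 2^k∣t) 2t∣u

  t-arc-deep : ∀ {u v} → TArc u v → Deep u
  t-arc-deep (_ , t∈T , arc) = proj₁ (t-arc-flips t∈T arc)

  t-arc-shallow : ∀ {u v} → TArc u v → ¬ Deep v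
  t-arc-shallow (_ , t∈T , arc) = proj₂ (t-arc-flips t∈T arc)

  t≢0 : ∀ {t} → t ∈ T → t ≢ 0
  t≢0 t∈T = Nu2⇒≢0 (All.lookup ν₂[T]≡k t∈T)

  ¬2a∣a : ¬ 2 * a ∣ a
  ¬2a∣a 2a∣a = <⇒≱ (m<m*n a 2 ≤-refl) (subst (_≤ a) (*-comm 2 a) (∣⇒≤ 2a∣a))
    where instance _ = ≢-nonZero a≢0

  a-arcs-disjoint : ∀ {u v w} → Arc a u v → ¬ Arc a v w
  a-arcs-disjoint (2a∣u , refl) (2a∣u+a , _) = ¬2a∣a (∣m+n∣m⇒∣n 2a∣u+a 2a∣u)

  a-arc-lower-unique : ∀ {u v w} → Arc a u v → Arc a w v → u ≡ w
  a-arc-lower-unique (_ , v≡u+a) (_ , v≡w+a) = +-cancelʳ-≡ a _ _ (trans (sym v≡u+a) v≡w+a)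

  a-arc-upper-unique : ∀ {u v w} → Arc a u v → Arc a u w → v ≡ w
  a-arc-upper-unique (_ , v≡u+a) (_ , w≡u+a) = trans v≡u+a (sym w≡u+a)

  classify : ∀ {u v} → Adj S u v → AEdge u v ⊎ TArc u v ⊎ TArc v u
  classify e with adj⇒arc e
  ... | _ , here refl , inj₁ arc = inj₁ (inj₁ arc)
  ... | _ , here refl , inj₂ arc = inj₁ (inj₂ arc)
  ... | t , there t∈T , inj₁ arc = inj₂ (inj₁ (t , t∈T , arc))
  ... | t , there t∈T , inj₂ arc = inj₂ (inj₂ (t , t∈T , arc))

  from-deep : ∀ {u v} → Adj S u v → Deep u → ¬ AEdge u v → TArc u v
  from-deep e deep-u ¬a-edge with classify e
  ... | inj₁ a-edge                 = contradiction a-edge ¬a-edge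
  ... | inj₂ (inj₁ arc)             = arc
  ... | inj₂ (inj₂ (_ , t∈T , arc)) = contradiction deep-u (proj₂ (t-arc-flips t∈T arc))

  into-shallow : ∀ {u v} → Adj S u v → ¬ Deep v → TArc u v
  into-shallow e ¬deep-v with classify e
  ... | inj₁ (inj₁ arc)             = contradiction (proj₂ (a-arc-deep arc)) ¬deep-v
  ... | inj₁ (inj₂ arc)             = contradiction (proj₁ (a-arc-deep arc)) ¬deep-v
  ... | inj₂ (inj₁ arc)             = arc
  ... | inj₂ (inj₂ (_ , t∈T , arc)) = contradiction (proj₁ (t-arc-flips t∈T arc)) ¬deep-v

  deep⇒shallow : ∀ {u v} → TEdge u v → Deep u → ¬ Deep v
  deep⇒shallow (inj₁ (_ , t∈T , arc)) _      = proj₂ (t-arc-flips t∈T arc)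
  deep⇒shallow (inj₂ (_ , t∈T , arc)) deep-u = contradiction deep-u (proj₂ (t-arc-flips t∈T arc))

  shallow⇒deep : ∀ {u v} → TEdge u v → ¬ Deep u → Deep v
  shallow⇒deep (inj₁ (_ , t∈T , arc)) ¬deep-u = contradiction (proj₁ (t-arc-flips t∈T arc)) ¬deep-u
  shallow⇒deep (inj₂ (_ , t∈T , arc)) _       = proj₁ (t-arc-flips t∈T arc)

  no-T-pentagon : ∀ {v₀ v₁ v₂ v₃ v₄} →
    TEdge v₀ v₁ → TEdge v₁ v₂ → TEdge v₂ v₃ → TEdge v₃ v₄ → TEdge v₄ v₀ → ⊥
  no-T-pentagon {v₀} e₀₁ e₁₂ e₂₃ e₃₄ e₄₀ = ¬deep-v₀ (shallow⇒deep e₄₀ (deep⇒shallow e₃₄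
    (shallow⇒deep e₂₃ (deep⇒shallow e₁₂ (shallow⇒deep e₀₁ ¬deep-v₀)))))
    where
    ¬deep-v₀ : ¬ Deep v₀
    ¬deep-v₀ deep-v₀ = deep⇒shallow e₄₀ (shallow⇒deep e₃₄
      (deep⇒shallow e₂₃ (shallow⇒deep e₁₂ (deep⇒shallow e₀₁ deep-v₀)))) deep-v₀

  a-edge-rotation : Pentagon (Adj S) → ∃[ P ] AEdge (Pentagon.v₀ P) (Pentagon.v₁ P)
  a-edge-rotation P with classify e₀₁ | classify e₁₂ | classify e₂₃ | classify e₃₄ | classify e₄₀
    where open Pentagon P
  ... | inj₁ a-edge | _ | _ | _ | _ = P , a-edge
  ... | inj₂ _ | inj₁ a-edge | _ | _ | _ = rotate P , a-edge
  ... | inj₂ _ | inj₂ _ | inj₁ a-edge | _ | _ = rotate (rotate P) , a-edge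
  ... | inj₂ _ | inj₂ _ | inj₂ _ | inj₁ a-edge | _ = rotate (rotate (rotate P)) , a-edge
  ... | inj₂ _ | inj₂ _ | inj₂ _ | inj₂ _ | inj₁ a-edge = rotate (rotate (rotate (rotate P))) , a-edge
  ... | inj₂ t₀₁ | inj₂ t₁₂ | inj₂ t₂₃ | inj₂ t₃₄ | inj₂ t₄₀ =
    ⊥-elim (no-T-pentagon t₀₁ t₁₂ t₂₃ t₃₄ t₄₀)

  upward-a-arc : Pentagon (Adj S) → ∃[ P ] Arc a (Pentagon.v₀ P) (Pentagon.v₁ P)
  upward-a-arc P with a-edge-rotation P
  ... | P′ , inj₁ up   = P′ , up
  ... | P′ , inj₂ down = reflect adj-sym P′ , down

  record Zigzag : Set where
    field
      v₀ v₁ v₂ v₃ v₄ p q r s : ℕ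
      p∈T : p ∈ T
      q∈T : q ∈ T
      r∈T : r ∈ T
      s∈T : s ∈ T
      a-arc : Arc a v₀ v₁
      p-arc : Arc p v₁ v₂
      q-arc : Arc q v₃ v₂
      r-arc : Arc r v₃ v₄
      s-arc : Arc s v₀ v₄
      p≢q : p ≢ q
      q≢r : q ≢ r
      r≢s : r ≢ s

  zigzag : ∀ {v₀ v₁ v₂ v₃ v₄} → Arc a v₀ v₁ → TArc v₁ v₂ → TArc v₃ v₂ → TArc v₃ v₄ → TArc v₀ v₄ →
           v₁ ≢ v₃ → v₂ ≢ v₄ → v₃ ≢ v₀ → Zigzag
  zigzag {v₀} {v₁} {v₂} {v₃} {v₄} a-arc (p , p∈T , p-arc) (q , q∈T , q-arc) (r , r∈T , r-arc)
         (s , s∈T , s-arc) v₁≢v₃ v₂≢v₄ v₃≢v₀ = record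
    { v₀ = v₀ ; v₁ = v₁ ; v₂ = v₂ ; v₃ = v₃ ; v₄ = v₄ ; p = p ; q = q ; r = r ; s = s
    ; p∈T = p∈T ; q∈T = q∈T ; r∈T = r∈T ; s∈T = s∈T
    ; a-arc = a-arc ; p-arc = p-arc ; q-arc = q-arc ; r-arc = r-arc ; s-arc = s-arc
    ; p≢q = λ { refl → v₁≢v₃ (+-cancelʳ-≡ p v₁ v₃ (trans (sym (proj₂ p-arc)) (proj₂ q-arc))) }
    ; q≢r = λ { refl → v₂≢v₄ (trans (proj₂ q-arc) (sym (proj₂ r-arc))) }
    ; r≢s = λ { refl → v₃≢v₀ (+-cancelʳ-≡ r v₃ v₀ (trans (sym (proj₂ r-arc)) (proj₂ s-arc))) }
    }

  pentagon⇒zigzag : (P : Pentagon (Adj S)) → Arc a (Pentagon.v₀ P) (Pentagon.v₁ P) → Zigzag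
  pentagon⇒zigzag P up = zigzag up p-arc q-arc r-arc s-arc v₁≢v₃ v₂≢v₄ v₃≢v₀
    where
    open Pentagon P
    p-arc = from-deep e₁₂ (proj₂ (a-arc-deep up)) λ
      { (inj₁ arc) → a-arcs-disjoint up arc
      ; (inj₂ arc) → v₀≢v₂ (a-arc-lower-unique up arc)
      }
    s-arc = from-deep (adj-sym e₄₀) (proj₁ (a-arc-deep up)) λ
      { (inj₁ arc) → v₄≢v₁ (a-arc-upper-unique arc up)
      ; (inj₂ arc) → a-arcs-disjoint arc up
      }
    q-arc = into-shallow (adj-sym e₂₃) (t-arc-shallow p-arc)
    r-arc = into-shallow e₃₄ (t-arc-shallow s-arc)

  cycle⇒zigzag : HasCycle S 5 → Zigzag
  cycle⇒zigzag = uncurry pentagon⇒zigzag ∘ upward-a-arc ∘ cycle⇒pentagon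

  module _ (Z : Zigzag) where

    open Zigzag Z

    zigzag-sum : a + p + r ≡ q + s
    zigzag-sum = +-cancelˡ-≡ v₀ _ _ (begin
      v₀ + (a + p + r)   ≡⟨ regroup v₀ a p r ⟩
      v₀ + a + p + r     ≡⟨ cong (λ t → t + p + r) (sym (proj₂ a-arc)) ⟩
      v₁ + p + r         ≡⟨ cong (_+ r) (sym (proj₂ p-arc)) ⟩
      v₂ + r             ≡⟨ cong (_+ r) (proj₂ q-arc) ⟩
      v₃ + q + r         ≡⟨ swap v₃ q r ⟩
      v₃ + r + q         ≡⟨ cong (_+ q) (sym (proj₂ r-arc)) ⟩
      v₄ + q             ≡⟨ cong (_+ q) (proj₂ s-arc) ⟩
      v₀ + s + q         ≡⟨ swap₀ v₀ s q ⟩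
      v₀ + (q + s)       ∎)
      where
      regroup : ∀ v a p r → v + (a + p + r) ≡ v + a + p + r
      regroup = solve-∀
      swap : ∀ v q r → v + q + r ≡ v + r + q
      swap = solve-∀
      swap₀ : ∀ v s q → v + s + q ≡ v + (q + s)
      swap₀ = solve-∀

    gcd[q,s]∣r : gcd q s ∣ r
    gcd[q,s]∣r = arc-∣-label r-arc d∣v₃ d∣v₄
      where
      d∣v₃ = ∣-trans (gcd[m,n]∣m q s) (arc-∣-lower q-arc)
      d∣v₄ = arc-∣-upper s-arc (∣-trans (gcd[m,n]∣n q s) (arc-∣-lower s-arc)) (gcd[m,n]∣n q s)

    gcd[p,r]∣q : gcd p r ∣ q
    gcd[p,r]∣q = arc-∣-label q-arc d∣v₃ d∣v₂
      where
      d∣v₃ = ∣-trans (gcd[m,n]∣n p r) (arc-∣-lower r-arc)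
      d∣v₂ = arc-∣-upper p-arc (∣-trans (gcd[m,n]∣m p r) (arc-∣-lower p-arc)) (gcd[m,n]∣m p r)

    gcd[a,q]∣p : gcd a q ∣ p
    gcd[a,q]∣p = arc-∣-label p-arc d∣v₁ d∣v₂
      where
      d∣v₁ = arc-∣-upper a-arc (∣-trans (gcd[m,n]∣m a q) (arc-∣-lower a-arc)) (gcd[m,n]∣m a q)
      d∣v₂ = arc-∣-upper q-arc (∣-trans (gcd[m,n]∣n a q) (arc-∣-lower q-arc)) (gcd[m,n]∣n a q)

    zigzag⇒cycle : HasCycle S 5
    zigzag⇒cycle = cycle-of-unique vs distinct steps (adj-sym (arc⇒adj (there s∈T) s-arc))
      where
      vs : Vec ℕ 5
      vs = v₀ ∷ v₁ ∷ v₂ ∷ v₃ ∷ v₄ ∷ []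
      steps : (i : Fin 4) → Adj S (lookup vs (inject₁ i)) (lookup vs (suc i))
      steps 0F = arc⇒adj (here refl) a-arc
      steps 1F = arc⇒adj (there p∈T) p-arc
      steps 2F = adj-sym (arc⇒adj (there q∈T) q-arc)
      steps 3F = arc⇒adj (there r∈T) r-arc
      deep≢shallow : ∀ {u v} → Deep u → ¬ Deep v → u ≢ v
      deep≢shallow deep-u ¬deep-v refl = ¬deep-v deep-u
      deep-v₀ = proj₁ (a-arc-deep a-arc)
      deep-v₁ = t-arc-deep (p , p∈T , p-arc)
      deep-v₃ = t-arc-deep (q , q∈T , q-arc)
      ¬deep-v₂ = t-arc-shallow (p , p∈T , p-arc)
      ¬deep-v₄ = t-arc-shallow (r , r∈T , r-arc)
      v₀≢v₁ : v₀ ≢ v₁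
      v₀≢v₁ v₀≡v₁ = m≢m+n v₀ a≢0 (trans v₀≡v₁ (proj₂ a-arc))
      v₁≢v₃ : v₁ ≢ v₃
      v₁≢v₃ v₁≡v₃ = p≢q (+-cancelˡ-≡ v₃ p q
        (trans (cong (_+ p) (sym v₁≡v₃)) (trans (sym (proj₂ p-arc)) (proj₂ q-arc))))
      v₂≢v₄ : v₂ ≢ v₄
      v₂≢v₄ v₂≡v₄ = q≢r (+-cancelˡ-≡ v₃ q r (trans (sym (proj₂ q-arc)) (trans v₂≡v₄ (proj₂ r-arc))))
      v₀≢v₃ : v₀ ≢ v₃
      v₀≢v₃ v₀≡v₃ = r≢s (+-cancelˡ-≡ v₃ r s
        (trans (sym (proj₂ r-arc)) (trans (proj₂ s-arc) (cong (_+ s) v₀≡v₃))))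
      distinct : Vec.Unique vs
      distinct = (v₀≢v₁ ∷ deep≢shallow deep-v₀ ¬deep-v₂ ∷ v₀≢v₃ ∷ deep≢shallow deep-v₀ ¬deep-v₄ ∷ [])
               ∷ (deep≢shallow deep-v₁ ¬deep-v₂ ∷ v₁≢v₃ ∷ deep≢shallow deep-v₁ ¬deep-v₄ ∷ [])
               ∷ (≢-sym (deep≢shallow deep-v₃ ¬deep-v₂) ∷ v₂≢v₄ ∷ [])
               ∷ (deep≢shallow deep-v₃ ¬deep-v₄ ∷ [])
               ∷ [] ∷ []

  2*-nonZero : ∀ {n} → n ≢ 0 → NonZero (2 * n)
  2*-nonZero n≢0 = ≢-nonZero (n≢0 ∘ m+n≡0⇒m≡0 _)

  2^k∣a : 2 ^ k ∣ a
  2^k∣a = ∣-trans (n∣m*n 2) 2^[1+k]∣a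

  triangle-at : ∀ {q r} → q ∈ T → r ∈ T → q ≡ a + r →
                ∃[ N ] (2 * a ∣ N) × (2 * q ∣ N) × (ℤ.+ (2 * r) ℤ.∣ ℤ.+ N ℤ.+ ℤ.+ a) → HasCycle S 3
  triangle-at {q} {r} q∈T r∈T q≡a+r (N , 2a∣N , 2q∣N , 2r∣N+a) =
    cycle-of-unique vs distinct steps (adj-sym (arc⇒adj (there q∈T) (2q∣N , refl)))
    where
    vs : Vec ℕ 3
    vs = N ∷ N + a ∷ N + q ∷ []
    steps : (i : Fin 2) → Adj S (lookup vs (inject₁ i)) (lookup vs (suc i))
    steps 0F = arc⇒adj (here refl) (2a∣N , refl)
    steps 1F = arc⇒adj (there r∈T) (ℤ.∣⇒∣ᵤ 2r∣N+a , trans (cong (N +_) q≡a+r) (sym (+-assoc N a r)))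
    N+a≢N+q : N + a ≢ N + q
    N+a≢N+q N+a≡N+q = m≢m+n a (t≢0 r∈T) (trans (+-cancelˡ-≡ N a q N+a≡N+q) q≡a+r)
    distinct : Vec.Unique vs
    distinct = (m≢m+n N a≢0 ∷ m≢m+n N (t≢0 q∈T) ∷ []) ∷ (N+a≢N+q ∷ []) ∷ [] ∷ []

  triangle : ∀ {q r} → q ∈ T → r ∈ T → q ≡ a + r → HasCycle S 3
  triangle {q} {r} q∈T r∈T q≡a+r = triangle-at q∈T r∈T q≡a+r
    (chinese-remainder (2 * a) (2 * q) (2 * r)
      {{2*-nonZero a≢0}} {{2*-nonZero (t≢0 q∈T)}} {{2*-nonZero (t≢0 r∈T)}} c₁ c₂ 0)
    where
    νr = All.lookup ν₂[T]≡k r∈T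
    gcd[r,q]∣a : gcd r q ∣ a
    gcd[r,q]∣a = ∣m+n∣m⇒∣n (subst (gcd r q ∣_) (trans q≡a+r (+-comm a r)) (gcd[m,n]∣n r q)) (gcd[m,n]∣m r q)
    c₁ : ℤ.+ gcd (2 * r) (2 * a) ℤ.∣ ℤ.+ a
    c₁ = gcd[2m,2n]∣ r a (Nu2-gcd νr 2^k∣a) (ℕ∣⇒ℤ∣ (gcd[m,n]∣n r a)) (ℕ∣⇒ℤ∣ 2^[1+k]∣a)
    c₂ : ℤ.+ gcd (2 * r) (2 * q) ℤ.∣ ℤ.+ a
    c₂ = gcd[2m,2n]∣ r q (Nu2-gcd νr (proj₁ (All.lookup ν₂[T]≡k q∈T)))
      (ℕ∣⇒ℤ∣ gcd[r,q]∣a) (ℕ∣⇒ℤ∣ 2^[1+k]∣a)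

  -- N + x is the vertex v₀ of the zigzag and N + z its vertex v₃ = v₀ + z - x.
  base-point : ∀ {x y z} → x ∈ T → y ∈ T → z ∈ T → a + x + x ≡ y + z → gcd y z ∣ x → gcd a y ∣ x →
               ∃[ N ] (2 * z ∣ x + N) × (2 * a ∣ x + N) × (2 * y ∣ N + z)
  base-point {x} {y} {z} x∈T y∈T z∈T a+2x≡y+z gcd[y,z]∣x gcd[a,y]∣x = shift-third
    (chinese-remainder (2 * z) (2 * a) (2 * y)
      {{2*-nonZero (t≢0 z∈T)}} {{2*-nonZero a≢0}} {{2*-nonZero (t≢0 y∈T)}} c₁ c₂ x)
    where
    νy = All.lookup ν₂[T]≡k y∈T
    2^[1+k]∣z-x : ℤ.+ (2 ^ suc k) ℤ.∣ ℤ.+ z ℤ.- ℤ.+ x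
    2^[1+k]∣z-x = Nu2⇒2^[1+k]∣m-n (All.lookup ν₂[T]≡k z∈T) (All.lookup ν₂[T]≡k x∈T)
    gcd[y,a]∣x : gcd y a ∣ x
    gcd[y,a]∣x = subst (_∣ x) (gcd-comm a y) gcd[a,y]∣x
    gcd[y,a]∣z : gcd y a ∣ z
    gcd[y,a]∣z = ∣m+n∣m⇒∣n (subst (gcd y a ∣_) a+2x≡y+z
      (∣m∣n⇒∣m+n (∣m∣n⇒∣m+n (gcd[m,n]∣n y a) gcd[y,a]∣x) gcd[y,a]∣x)) (gcd[m,n]∣m y a)
    c₁ : ℤ.+ gcd (2 * y) (2 * z) ℤ.∣ ℤ.+ z ℤ.- ℤ.+ x
    c₁ = gcd[2m,2n]∣ y z (Nu2-gcd νy (proj₁ (All.lookup ν₂[T]≡k z∈T)))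
      (ℤ.∣m∣n⇒∣m-n (ℕ∣⇒ℤ∣ (gcd[m,n]∣n y z)) (ℕ∣⇒ℤ∣ gcd[y,z]∣x)) 2^[1+k]∣z-x
    c₂ : ℤ.+ gcd (2 * y) (2 * a) ℤ.∣ ℤ.+ z ℤ.- ℤ.+ x
    c₂ = gcd[2m,2n]∣ y a (Nu2-gcd νy 2^k∣a)
      (ℤ.∣m∣n⇒∣m-n (ℕ∣⇒ℤ∣ gcd[y,a]∣z) (ℕ∣⇒ℤ∣ gcd[y,a]∣x)) 2^[1+k]∣z-x
    shift-third :
      ∃[ N ] (2 * z ∣ x + N) × (2 * a ∣ x + N) × (ℤ.+ (2 * y) ℤ.∣ ℤ.+ (x + N) ℤ.+ (ℤ.+ z ℤ.- ℤ.+ x)) →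
      ∃[ N ] (2 * z ∣ x + N) × (2 * a ∣ x + N) × (2 * y ∣ N + z)
    shift-third (N , 2z∣x+N , 2a∣x+N , 2y∣[x+N]+[z-x]) = N , 2z∣x+N , 2a∣x+N ,
      ℤ.∣⇒∣ᵤ (subst (ℤ.+ (2 * y) ℤ.∣_) (+[m+n]+[o-m]≡+[n+o] x N z) 2y∣[x+N]+[z-x])

  labelled-zigzag : ∀ {x y z} → x ∈ T → y ∈ T → z ∈ T → x ≢ y → x ≢ z → a + x + x ≡ y + z → x ∣ y →
                    ∃[ N ] (2 * z ∣ x + N) × (2 * a ∣ x + N) × (2 * y ∣ N + z) → Zigzag
  labelled-zigzag {x} {y} {z} x∈T y∈T z∈T x≢y x≢z a+2x≡y+z x∣y (N , 2z∣v₀ , 2a∣v₀ , 2y∣v₃) = record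
    { v₀ = x + N ; v₁ = x + N + a ; v₂ = N + z + y ; v₃ = N + z ; v₄ = N + z + x
    ; p = x ; q = y ; r = x ; s = z
    ; p∈T = x∈T ; q∈T = y∈T ; r∈T = x∈T ; s∈T = z∈T
    ; a-arc = 2a∣v₀ , refl
    ; p-arc = 2x∣v₁ , v₂≡v₁+x
    ; q-arc = 2y∣v₃ , refl
    ; r-arc = 2x∣v₃ , refl
    ; s-arc = 2z∣v₀ , regroup N z x
    ; p≢q = x≢y ; q≢r = ≢-sym x≢y ; r≢s = x≢z
    }
    where
    regroup : ∀ N z x → N + z + x ≡ x + N + z
    regroup = solve-∀
    νx = All.lookup ν₂[T]≡k x∈T
    d = y ∸ x
    y≡x+d : y ≡ x + d
    y≡x+d = sym (m+[n∸m]≡n (∣⇒≤ {{≢-nonZero (t≢0 y∈T)}} x∣y))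
    2^[1+k]∣d : 2 ^ suc k ∣ d
    2^[1+k]∣d = ∣m+n∣m⇒∣n
      (subst (2 ^ suc k ∣_) (trans (cong (x +_) y≡x+d) (sym (+-assoc x x d)))
        (Nu2⇒2^[1+k]∣m+n νx (All.lookup ν₂[T]≡k y∈T)))
      (Nu2⇒2^[1+k]∣m+n νx νx)
    2x∣d : 2 * x ∣ d
    2x∣d = Nu2⇒2m∣n νx (∣m+n∣m⇒∣n (subst (x ∣_) y≡x+d x∣y) ∣-refl) 2^[1+k]∣d
    2x∣v₃ : 2 * x ∣ N + z
    2x∣v₃ = ∣-trans (*-monoʳ-∣ 2 x∣y) 2y∣v₃
    v₂≡v₁+x : N + z + y ≡ x + N + a + x
    v₂≡v₁+x = begin
      N + z + y       ≡⟨ swap N z y ⟩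
      N + (y + z)     ≡⟨ cong (N +_) (sym a+2x≡y+z) ⟩
      N + (a + x + x) ≡⟨ spread N a x ⟩
      x + N + a + x   ∎
      where
      swap : ∀ N z y → N + z + y ≡ N + (y + z)
      swap = solve-∀
      spread : ∀ N a x → N + (a + x + x) ≡ x + N + a + x
      spread = solve-∀
    v₁≡v₃+d : x + N + a ≡ N + z + d
    v₁≡v₃+d = +-cancelʳ-≡ x _ _ (begin
      x + N + a + x   ≡⟨ sym v₂≡v₁+x ⟩
      N + z + y       ≡⟨ cong (N + z +_) y≡x+d ⟩
      N + z + (x + d) ≡⟨ swap (N + z) x d ⟩
      N + z + d + x   ∎)
      where
      swap : ∀ v x d → v + (x + d) ≡ v + d + x
      swap = solve-∀
    2x∣v₁ : 2 * x ∣ x + N + a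
    2x∣v₁ = subst (2 * x ∣_) (sym v₁≡v₃+d) (∣m∣n⇒∣m+n 2x∣v₃ 2x∣d)

  module _ (T-unique : Unique T) where

    labelling⇒zigzag : FiveCycleLabelling a T → Zigzag
    labelling⇒zigzag (x , y , z , xyz↭T , sign , x∣y , gcd[y,z]∣x , gcd[a,y]∣x)
      with Unique-resp-↭ (↭⇒↭ₛ (↭-sym xyz↭T)) T-unique
    ... | (x≢y ∷ x≢z ∷ []) ∷ _ =
      labelled-zigzag x∈T y∈T z∈T x≢y x≢z sum x∣y (base-point x∈T y∈T z∈T sum gcd[y,z]∣x gcd[a,y]∣x)
      where
      x∈T = ∈-resp-↭ xyz↭T (here refl)
      y∈T = ∈-resp-↭ xyz↭T (there (here refl))
      z∈T = ∈-resp-↭ xyz↭T (there (there (here refl)))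
      sum = balanced⇒sum a≢0 x∣y x≢y (t≢0 y∈T) sign

  module _ (|T|≤3 : length T ≤ 3) (no-triangle : ∀ {q r} → q ∈ T → r ∈ T → q ≢ a + r)
           (Z : Zigzag) where

    open Zigzag Z

    private
      by-cases : Dec (r ≡ p) → Dec (s ≡ q) → FiveCycleLabelling a T
      by-cases (yes r≡p) (yes s≡q) = contradiction (∣-antisym p∣q q∣p) p≢q
        where
        p∣q = ∣-trans (n≡m⇒m∣gcd[m,n] r≡p) (gcd[p,r]∣q Z)
        q∣p = subst (q ∣_) r≡p (∣-trans (n≡m⇒m∣gcd[m,n] s≡q) (gcd[q,s]∣r Z))
      by-cases (yes r≡p) (no s≢q) =
        p , q , s , pqs↭T , sum⇒balanced a+2p≡q+s ,
        p∣q , subst (gcd q s ∣_) r≡p (gcd[q,s]∣r Z) , gcd[a,q]∣p Z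
        where
        p∣q = ∣-trans (n≡m⇒m∣gcd[m,n] r≡p) (gcd[p,r]∣q Z)
        a+2p≡q+s = subst (λ t → a + p + t ≡ q + s) r≡p (zigzag-sum Z)
        pqs↭T = ↭-of-distinct-members
          ((p≢q ∷ (λ p≡s → r≢s (trans r≡p p≡s)) ∷ []) ∷ (≢-sym s≢q ∷ []) ∷ [] ∷ [])
          (p∈T ∷ q∈T ∷ s∈T ∷ []) |T|≤3
      by-cases (no r≢p) (yes s≡q) = contradiction (m+n≡0⇒m≡0 a (m+n≤n⇒m≡0 a+p+r≤r)) a≢0
        where
        q∣r = ∣-trans (n≡m⇒m∣gcd[m,n] s≡q) (gcd[q,s]∣r Z)
        a+p+r≤r : a + p + r ≤ r
        a+p+r≤r = subst (_≤ r) (sym (trans (zigzag-sum Z) (cong (q +_) s≡q)))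
          (m∣n∧m≢n⇒m+m≤n q∣r q≢r (t≢0 r∈T))
      by-cases (no r≢p) (no s≢q) with ∈-resp-↭ (↭-sym pqr↭T) s∈T
        where
        pqr↭T = ↭-of-distinct-members
          ((p≢q ∷ ≢-sym r≢p ∷ []) ∷ (q≢r ∷ []) ∷ [] ∷ []) (p∈T ∷ q∈T ∷ r∈T ∷ []) |T|≤3
      ... | here s≡p = contradiction q≡a+r (no-triangle q∈T r∈T)
        where
        swap : ∀ a p r → a + p + r ≡ a + r + p
        swap = solve-∀
        q≡a+r = +-cancelʳ-≡ p q (a + r)
          (trans (cong (q +_) (sym s≡p)) (trans (sym (zigzag-sum Z)) (swap a p r)))
      ... | there (here s≡q) = contradiction s≡q s≢q
      ... | there (there (here s≡r)) = contradiction (sym s≡r) r≢s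

    zigzag⇒labelling : FiveCycleLabelling a T
    zigzag⇒labelling = by-cases (r ≟ p) (s ≟ q)

open import Data.Integer using (ℤ; +_; -_; _-_; _*_)

claim24 : (a x y z : ℕ) →
    a > 0 → x > 0 → y > 0 → z > 0 →
    a ≢ x → a ≢ y → a ≢ z → x ≢ y → x ≢ z → y ≢ z →
    gcd (gcd (gcd a x) y) z ≡ 1 →
    (Σ ℕ λ k → Σ ℕ λ m → Nu2 x k × Nu2 y k × Nu2 z k × Nu2 a m × k < m) →
    ¬ HasCycle (a ∷ x ∷ y ∷ z ∷ []) 3 →
    (HasCycle (a ∷ x ∷ y ∷ z ∷ []) 5 ⇔
      (Σ ℕ λ x′ → Σ ℕ λ y′ → Σ ℕ λ z′ →
        ((x′ ∷ y′ ∷ z′ ∷ []) ↭ (x ∷ y ∷ z ∷ [])) ×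
        ((+ a ≡ (+ 2) * (+ x′) - (+ y′) - (+ z′)) ⊎ (+ a ≡ - ((+ 2) * (+ x′) - (+ y′) - (+ z′)))) ×
        (x′ ∣ y′) × (gcd y′ z′ ∣ x′) × (gcd a y′ ∣ x′)))
claim24 a x y z a>0 _ _ _ _ _ _ x≢y x≢z y≢z _ (k , m , νx , νy , νz , νa , k<m) no-3-cycle =
  mk⇔ (λ five-cycle → zigzag⇒labelling ≤-refl no-triangle (cycle⇒zigzag five-cycle))
      (λ labelling → zigzag⇒cycle (labelling⇒zigzag T-unique labelling))
  where
  open SkipGraph a k (x ∷ y ∷ z ∷ []) (>⇒≢ a>0) (∣-trans (^-monoʳ-∣ 2 k<m) (proj₁ νa))
                 (νx ∷ νy ∷ νz ∷ [])
  T-unique : Unique (x ∷ y ∷ z ∷ [])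
  T-unique = (x≢y ∷ x≢z ∷ []) ∷ (y≢z ∷ []) ∷ [] ∷ []
  no-triangle : ∀ {q r} → q ∈ (x ∷ y ∷ z ∷ []) → r ∈ (x ∷ y ∷ z ∷ []) → q ≢ a + r
  no-triangle q∈T r∈T q≡a+r = no-3-cycle (triangle q∈T r∈T q≡a+r)
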